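{- Let $k\colon1\to1$ be a morphism of $\mathrm{Mat}_{\mathbb N}$ (i.e. a $1\times1$ matrix $(k)$ with $k\in\mathbb N$). Then $\mathrm{mwd}(k)\le2$.
   Context: $\mathrm{Mat}_{\mathbb N}$ is the prop (strict symmetric monoidal category with objects the natural numbers, $m\otimes n=m+n$) whose morphisms $n\to m$ are $m\times n$ matrices over $\mathbb N$; the composite of $A\colon n\to k$ followed by $B\colon k\to m$ is $B\cdot A$; $A\otimes B=\begin{pmatrix}A&0\\0&B\end{pmatrix}$. Atoms: $\mathrm{cp}_1=\begin{pmatrix}1\\1\end{pmatrix}\colon1\to2$, $\mathrm{del}_1\colon1\to0$ (the $0\times1$ matrix), $\mathrm{add}_1=(1\ 1)\colon2\to1$, $\mathrm{zero}_1\colon0\to1$ (the $1\times0$ matrix), $\sigma_{1,1}=\begin{pmatrix}0&1\\1&0\end{pmatrix}$, $\mathrm{id}_1=(1)$. Weights: $w(n)=n$ on objects, $w(g)=\max\{m,n\}$ for an atom $g\colon n\to m$. Monoidal decompositions $D(f)$ of $f\colon a\to b$: a leaf $(f)$ if $f$ is an atom; $(d_1\otimes d_2)$ with $d_i\in D(f_i)$, $f=f_1\otimes f_2$; $(d_1;_jd_2)$ with $d_1\in D(f_1\colon a\to j)$, $d_2\in D(f_2\colon j\to b)$, $f$ the composite of $f_1$ then $f_2$. Width: $\mathrm{wd}((f))=w(f)$, $\mathrm{wd}(d_1\otimes d_2)=\max\{\mathrm{wd}(d_1),\mathrm{wd}(d_2)\}$, $\mathrm{wd}(d_1;_jd_2)=\max\{\mathrm{wd}(d_1),j,\mathrm{wd}(d_2)\}$;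 $\mathrm{mwd}(f)=\min_{d\in D(f)}\mathrm{wd}(d)$. -}

module Defs where

open import Data.Nat using (ℕ; zero; suc; _+_; _*_; _⊔_)
open import Data.Vec using (Vec; []; _∷_; map; zipWith; _++_; replicate; transpose; foldr)

-- A morphism n → m of Mat_ℕ: an m × n matrix over ℕ, stored as m rows of length n.
Mat : ℕ → ℕ → Set
Mat n m = Vec (Vec ℕ n) m

dot : ∀ {k} → Vec ℕ k → Vec ℕ k → ℕ
dot r c = foldr (λ _ → ℕ) _+_ 0 (zipWith _*_ r c)

_·_ : ∀ {n k m} → Mat k m → Mat n k → Mat n m
B · A = map (λ row → map (λ col → dot row col) (transpose A)) B

_⊗_ : ∀ {n₁ m₁ n₂ m₂} → Mat n₁ m₁ → Mat n₂ m₂ → Mat (n₁ + n₂) (m₁ + m₂)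
_⊗_ {n₁} {m₁} {n₂} {m₂} A B =
  map (λ r → r ++ replicate n₂ 0) A ++ map (λ r → replicate n₁ 0 ++ r) B

cp₁ : Mat 1 2
cp₁ = (1 ∷ []) ∷ (1 ∷ []) ∷ []

del₁ : Mat 1 0
del₁ = []

add₁ : Mat 2 1
add₁ = (1 ∷ 1 ∷ []) ∷ []

zero₁ : Mat 0 1
zero₁ = [] ∷ []

σ₁₁ : Mat 2 2
σ₁₁ = (0 ∷ 1 ∷ []) ∷ (1 ∷ 0 ∷ []) ∷ []

id₁ : Mat 1 1
id₁ = (1 ∷ []) ∷ []

data Atom : ∀ {n m} → Mat n m → Set where
  a-cp   : Atom cp₁
  a-del  : Atom del₁
  a-add  : Atom add₁
  a-zero : Atom zero₁
  a-σ    : Atom σ₁₁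
  a-id   : Atom id₁

data D : ∀ {a b} → Mat a b → Set where
  leaf : ∀ {a b} {f : Mat a b} → Atom f → D f
  tens : ∀ {a₁ b₁ a₂ b₂} {f₁ : Mat a₁ b₁} {f₂ : Mat a₂ b₂} →
         D f₁ → D f₂ → D (f₁ ⊗ f₂)
  comp : ∀ {a j b} {f₁ : Mat a j} {f₂ : Mat j b} →
         D f₁ → D f₂ → D (f₂ · f₁)

wd : ∀ {a b} {f : Mat a b} → D f → ℕ
wd (leaf {a} {b} _) = a ⊔ b
wd (tens d₁ d₂) = wd d₁ ⊔ wd d₂
wd (comp {j = j} d₁ d₂) = wd d₁ ⊔ j ⊔ wd d₂

module Submission where

open import Defs
open import Data.Nat using (ℕ; suc; _+_; _*_; _≤_; z≤n; s≤s)
open import Data.Nat.Properties using (⊔-lub; ≤-refl)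
open import Data.Nat.Tactic.RingSolver using (solve-∀)
open import Data.Vec using ([]; _∷_)
open import Data.Product using (Σ; _,_)
open import Relation.Binary.PropositionalEquality using (_≡_; refl; cong; subst)

-- The scalar k is built from 0 by iterating k ↦ add₁ ∘ (k ⊗ id₁) ∘ cp₁, whose
-- interfaces never exceed two wires.

Width≤ : ∀ {a b} → ℕ → Mat a b → Set
Width≤ w f = Σ (D f) (λ d → wd d ≤ w)

comp-width≤ : ∀ {a j b w} {f : Mat a j} {g : Mat j b} →
              Width≤ w f → j ≤ w → Width≤ w g → Width≤ w (g · f)
comp-width≤ (d , d≤w) j≤w (e , e≤w) = comp d e , ⊔-lub (⊔-lub d≤w j≤w) e≤w

tens-width≤ : ∀ {a₁ b₁ a₂ b₂ w} {f : Mat a₁ b₁} {g : Mat a₂ b₂} →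
              Width≤ w f → Width≤ w g → Width≤ w (f ⊗ g)
tens-width≤ (d , d≤w) (e , e≤w) = tens d e , ⊔-lub d≤w e≤w

atom-width≤2 : ∀ {a b} {f : Mat a b} → Atom f → Width≤ 2 f
atom-width≤2 a-cp   = leaf a-cp   , s≤s (s≤s z≤n)
atom-width≤2 a-del  = leaf a-del  , s≤s z≤n
atom-width≤2 a-add  = leaf a-add  , s≤s (s≤s z≤n)
atom-width≤2 a-zero = leaf a-zero , s≤s z≤n
atom-width≤2 a-σ    = leaf a-σ    , s≤s (s≤s z≤n)
atom-width≤2 a-id   = leaf a-id   , s≤s z≤n

scalar : ℕ → Mat 1 1
scalar k = (k ∷ []) ∷ []

scalar-zero : zero₁ · del₁ ≡ scalar 0
scalar-zero = refl

scalar-suc : ∀ k → add₁ · ((scalar k ⊗ id₁) · cp₁) ≡ scalar (suc k)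
scalar-suc k = cong scalar (entry k)
  where
  -- the single entry of the product, as the matrix operations normalise it
  entry : ∀ n → n * 1 + 0 + 0 + 1 ≡ suc n
  entry = solve-∀

scalar-width≤2 : ∀ k → Width≤ 2 (scalar k)
scalar-width≤2 0 =
  subst (Width≤ 2) scalar-zero
    (comp-width≤ (atom-width≤2 a-del) z≤n (atom-width≤2 a-zero))
scalar-width≤2 (suc k) =
  subst (Width≤ 2) (scalar-suc k)
    (comp-width≤
      (comp-width≤ (atom-width≤2 a-cp) ≤-refl
                   (tens-width≤ (scalar-width≤2 k) (atom-width≤2 a-id)))
      ≤-refl (atom-width≤2 a-add))

lemma4p7 : (f : Mat 1 1) → Σ (D f) (λ d → wd d ≤ 2)
lemma4p7 ((k ∷ []) ∷ []) = scalar-width≤2 k
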